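{- Let $D$ be a digraph with a partition $\{X,Y\}$ of $V(D)$ such that $D[X]$ is traceable and $Y$ is a stable set of $D$. Let $P=(x_1,x_2,\ldots,x_\ell)$ be a Hamiltonian path of $D[X]$ that is zigzag-free in $D$, and let $y\in Y$ be a vertex adjacent to each of $x_1,\ldots,x_t$ (for some $1\le t\le \ell$). Then $(x_i,y)\in A(D)$ for $i=1,2,\ldots,t$.
   Context: Digraphs have no loops and no parallel arcs (directed 2-cycles allowed). Two vertices $u,v$ are adjacent if $(u,v)\in A(D)$ or $(v,u)\in A(D)$; a stable set is a set of pairwise non-adjacent vertices. A Hamiltonian path $P=(x_1,\ldots,x_\ell)$ of $D[X]$ is zigzag-free in $D$ if there is no vertex $y\in Y$ such that $(y,x_1)\in A(D)$, or $(x_\ell,y)\in A(D)$, or $(x_i,y)\in A(D)$ and $(y,x_{i+1})\in A(D)$ for some $1\le i<\ell$. -}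

module Defs where

open import Data.Nat using (ℕ; suc; _<_)
open import Data.Fin using (Fin; toℕ; zero; suc; inject₁; fromℕ)
open import Data.Bool using (Bool; true; false)
open import Data.Product using (Σ; _×_; _,_; ∃)
open import Data.Sum using (_⊎_)
open import Relation.Binary.PropositionalEquality using (_≡_)
open import Relation.Nullary using (¬_)
open import Function.Definitions using (Injective)
open import Level using (0ℓ)

-- A digraph on the vertex set Fin n: an arc relation, with no loops.
-- (No parallel arcs is automatic for a relation; directed 2-cycles allowed.)
record Digraph (n : ℕ) : Set₁ where
  field
    Arc     : Fin n → Fin n → Set
    noLoops : ∀ v → ¬ Arc v v
open Digraph public

Adjacent : ∀ {n} → Digraph n → Fin n → Fin n → Set
Adjacent D u v = Arc D u v ⊎ Arc D v u

InX InY : ∀ {n} → (Fin n → Bool) → Fin n → Set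
InX inX v = inX v ≡ true
InY inX v = inX v ≡ false

Stable : ∀ {n} → Digraph n → (Fin n → Set) → Set
Stable D S = ∀ u v → S u → S v → ¬ Adjacent D u v

-- A path (x_1, …, x_ℓ) with ℓ = suc m is a map Fin (suc m) → Fin n.
IsHamPathOf : ∀ {n m} → Digraph n → (Fin n → Bool) → (Fin (suc m) → Fin n) → Set
IsHamPathOf {n} {m} D inX x =
  Injective _≡_ _≡_ x
  × (∀ i → InX inX (x i))
  × (∀ v → InX inX v → ∃ λ i → x i ≡ v)
  × (∀ (i : Fin m) → Arc D (x (inject₁ i)) (x (suc i)))

Traceable : ∀ {n} → Digraph n → (Fin n → Bool) → Set
Traceable {n} D inX = Σ ℕ λ m → Σ (Fin (suc m) → Fin n) λ x → IsHamPathOf D inX x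

ZigzagFree : ∀ {n m} → Digraph n → (Fin n → Bool) → (Fin (suc m) → Fin n) → Set
ZigzagFree {n} {m} D inX x =
  ∀ y → InY inX y →
    ¬ Arc D y (x zero)
    × ¬ Arc D (x (fromℕ m)) y
    × (∀ (i : Fin m) → ¬ (Arc D (x (inject₁ i)) y × Arc D y (x (suc i))))

module Submission where

open import Defs
open import Data.Nat using (ℕ; suc; _<_; _≤_)
open import Data.Nat.Properties using (<⇒≤)
open import Data.Fin using (Fin; toℕ; zero; suc; inject₁)
open import Data.Fin.Induction using (<-weakInduction)
open import Data.Fin.Properties using (toℕ-inject₁)
open import Data.Bool using (Bool)
open import Data.Product using (_×_; _,_; proj₁; proj₂)
open import Data.Sum using (_⊎_; inj₁; inj₂)
open import Data.Empty using (⊥-elim)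
open import Relation.Binary.PropositionalEquality using (sym; subst)
open import Relation.Nullary using (¬_)

-- Read In i as "x_i → y" and Out i as "y → x_i". Going along the prefix, In i
-- rules out Out (1 + i), so adjacency of x_{1+i} forces In (1 + i).
prefix-all-in : ∀ {m} (In Out : Fin (suc m) → Set) (t : ℕ) →
  ¬ Out zero →
  (∀ (i : Fin m) → ¬ (In (inject₁ i) × Out (suc i))) →
  (∀ i → toℕ i < t → In i ⊎ Out i) →
  ∀ i → toℕ i < t → In i
prefix-all-in {m} In Out t ¬out₀ ¬inOut inOrOut =
  <-weakInduction (λ i → toℕ i < t → In i) base step
  where
  base : toℕ {suc m} zero < t → In zero
  base 0<t with inOrOut zero 0<t
  ... | inj₁ in₀  = in₀
  ... | inj₂ out₀ = ⊥-elim (¬out₀ out₀)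

  step : ∀ i → (toℕ (inject₁ i) < t → In (inject₁ i)) → toℕ (suc i) < t → In (suc i)
  step i ih 1+i<t with inOrOut (suc i) 1+i<t
  ... | inj₁ in₁₊ᵢ  = in₁₊ᵢ
  ... | inj₂ out₁₊ᵢ =
    ⊥-elim (¬inOut i (ih (subst (_< t) (sym (toℕ-inject₁ i)) (<⇒≤ 1+i<t)) , out₁₊ᵢ))

lemma5 : ∀ {n} (D : Digraph n) (inX : Fin n → Bool) →
    Traceable D inX →
    Stable D (InY inX) →
    ∀ (m : ℕ) (x : Fin (suc m) → Fin n) →
    IsHamPathOf D inX x →
    ZigzagFree D inX x →
    ∀ (y : Fin n) → InY inX y →
    ∀ (t : ℕ) → 1 ≤ t → t ≤ suc m →
    (∀ (i : Fin (suc m)) → toℕ i < t → Adjacent D (x i) y) →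
    ∀ (i : Fin (suc m)) → toℕ i < t → Arc D (x i) y
lemma5 D inX _ _ m x _ zigzagFree y y∈Y t _ _ adjacent =
  prefix-all-in (λ i → Arc D (x i) y) (λ i → Arc D y (x i)) t
    (proj₁ (zigzagFree y y∈Y))
    (proj₂ (proj₂ (zigzagFree y y∈Y)))
    adjacent
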